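{- For all positive integers $n$ and $m$ with $4 \leq m \leq n$, $$\rho\hat{\;}(\mathbb{Z}_n,m,3) \leq \begin{cases} \min\{u(n,m,3),\, 3m-3-\gcd(n,m-1)\} & \text{if } \gcd(n,m-1)\geq 8;\\ \min\{u(n,m,3),\, 3m-10\} & \text{if } \gcd(n,m-1)=7, \text{ or } \gcd(n,m-1)\le 5,\ 3\mid n,\ 3\mid m, \text{ or } \gcd(n,m-1)\le 5,\ (3m-9)\mid n,\ 5\mid (m-3);\\ \min\{u(n,m,3),\, 3m-9\} & \text{if } \gcd(n,m-1)=6, \text{ or } m=6,\ 10\mid n,\ 3\nmid n;\\ \min\{u(n,m,3),\, 3m-8\} & \text{otherwise.}\end{cases}$$
   Context: For a subset $A$ of $\mathbb{Z}_n$, $3\hat{\;}A$ is the set of sums of $3$ distinct elements of $A$, and $\rho\hat{\;}(\mathbb{Z}_n,m,3) = \min\{|3\hat{\;}A| : A\subseteq\mathbb{Z}_n, |A|=m\}$. Also $u(n,m,h) = \min\{ (h\lceil m/d\rceil - h+1)\, d : d \text{ a positive divisor of } n\}$. -}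

module Defs where

open import Data.Nat using (_≟_; ℕ; zero; suc; _+_; _*_; _∸_; _⊓_; _/_; _≤_; _<?_; NonZero)
open import Data.Nat.DivMod using (_mod_)
open import Data.Nat.Divisibility using (_∣?_)
open import Data.Bool using (Bool; true; false; _∧_; if_then_else_)
open import Data.Fin using (Fin; toℕ)
open import Data.Fin.Subset using (Subset; ⋃; ⁅_⁆; ∣_∣; _∈_)
open import Data.Fin.Subset.Properties using (_∈?_)
open import Data.List using (List; []; _∷_; concatMap; map; filter; foldr; applyUpTo)
open import Data.List.Base using (allFin)
open import Data.Vec using (_∷_; [])
open import Relation.Nullary.Decidable using (⌊_⌋)

allSubsets : (n : ℕ) → List (Subset n)
allSubsets zero = [] ∷ []
allSubsets (suc n) =
  concatMap (λ s → (false ∷ s) ∷ (true ∷ s) ∷ []) (allSubsets n)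

-- boolean test: a < b < c (as elements of Fin n, by value) and a, b, c ∈ A;
-- i.e. {a,b,c} is a 3-element subset of A (each such set listed exactly once)
distinctTripleIn : ∀ {n} → Subset n → Fin n → Fin n → Fin n → Bool
distinctTripleIn A a b c =
  ⌊ toℕ a <? toℕ b ⌋ ∧ ⌊ toℕ b <? toℕ c ⌋ ∧ ⌊ a ∈? A ⌋ ∧ ⌊ b ∈? A ⌋ ∧ ⌊ c ∈? A ⌋

addZ : ∀ (n : ℕ) .{{_ : NonZero n}} → Fin n → Fin n → Fin n → Fin n
addZ n a b c = (toℕ a + toℕ b + toℕ c) mod n

hat3 : ∀ (n : ℕ) .{{_ : NonZero n}} → Subset n → Subset n
hat3 n A =
  ⋃ (concatMap (λ a → concatMap (λ b → concatMap (λ c →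
        if distinctTripleIn A a b c then ⁅ addZ n a b c ⁆ ∷ [] else [])
      (allFin n)) (allFin n)) (allFin n))

minList : ℕ → List ℕ → ℕ
minList d [] = d
minList d (x ∷ xs) = foldr _⊓_ x xs

-- ρ^(Z_n, m, 3) = min { |3^A| : A ⊆ Z_n, |A| = m }
-- (the default n for the empty list is never used when m ≤ n)
rhoHat3 : ∀ (n : ℕ) .{{_ : NonZero n}} → ℕ → ℕ
rhoHat3 n m =
  minList n (map (λ A → ∣ hat3 n A ∣)
                 (filter (λ A → ∣ A ∣ ≟ m) (allSubsets n)))

ceilDiv : ℕ → (d : ℕ) .{{_ : NonZero d}} → ℕ
ceilDiv m d = (m + d ∸ 1) / d

divisors : ℕ → List ℕ
divisors n = filter (λ d → d ∣? n) (applyUpTo suc n)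

u : ℕ → ℕ → ℕ → ℕ
u n m h = minList 0 (map term (divisors n))
  where
  term : ℕ → ℕ
  term zero = 0   -- never used: divisors are positive
  term (suc k) = (h * ceilDiv m (suc k) ∸ h + 1) * suc k

{-# OPTIONS --safe #-}
module Submission where

-- Every bound is witnessed by an explicit m-element set A ⊆ ℤ_n.  Writing
-- n = d q, the elements of A are two-digit numbers s + t q with s < q and
-- t < d; the sum of three of them is determined modulo n by the sum of the
-- low digits and the sum of the high digits modulo d, so |3^A| is at most the
-- number of such pairs that occur.  An initial segment of {0,…,K−1} + ⟨q⟩
-- gives u(n,m,3).  With g = gcd(n, m−1) and K = (m−1)/g, the set
-- {0,…,K−1} + ⟨n/g⟩ together with the single element K gives 3m − 3 − g,
-- since only one summand can have low digit K.  An interval gives 3m − 8.  When 3 ∣ n and 3 ∣ m, the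
-- two extreme low-digit sums force the high digits to be 0, 1, 2, which
-- saves two more sums.  The sporadic cases m = 6 and m = 8 come from explicit
-- sets in ℤ₁₀ and ℤ₁₅ carried into ℤ_n by the subgroup of order 10 or 15.

open import Defs
open import Data.Bool using (T; true; false)
open import Data.Bool.Properties using (T-∧; T-≡)
open import Data.Empty using (⊥; ⊥-elim)
open import Data.Fin using (Fin; toℕ; fromℕ<; inject≤; #_) renaming (zero to fzero; suc to fsuc)
open import Data.Fin.Properties
  using (toℕ-fromℕ<; toℕ-injective; toℕ<n; toℕ-inject≤; inject≤-injective; all?)
  renaming (_≟_ to _≟ᶠ_; suc-injective to fsuc-injective)
import Data.Fin.Subset as Subset
open import Data.Fin.Subset using (Subset; ⋃; ⁅_⁆; _∈_; _∉_; _∪_; inside; outside)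
open import Data.Fin.Subset.Properties
  using (x∈p∪q⁻; x∈p∪q⁺; ∉⊥; x∈⁅y⁆⇒x≡y; x∈⁅x⁆; ∪-identityˡ; ∣⊥∣≡0; p⊆q⇒∣p∣≤∣q∣; _∈?_)
open import Data.List
  using (List; []; _∷_; map; foldr; length; tabulate; concatMap; upTo; applyUpTo; cartesianProduct)
open import Data.List.Base using (allFin)
open import Data.List.Properties using (length-map; length-++; length-upTo; length-applyUpTo)
open import Data.List.Membership.Propositional using () renaming (_∈_ to _∈ₗ_)
open import Data.List.Membership.Propositional.Properties
  using (∈-tabulate⁻; ∈-map⁺; ∈-map⁻; ∈-filter⁺; ∈-filter⁻; ∈-concatMap⁺; ∈-upTo⁺; ∈-applyUpTo⁺;
         ∈-applyUpTo⁻; ∈-cartesianProduct⁺)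
open import Data.List.Relation.Unary.Any as Any using (Any; here; there; satisfied)
open import Data.List.Relation.Unary.Any.Properties using (map⁺; map⁻; concatMap⁻)
open import Data.Nat
  using (ℕ; zero; suc; _+_; _*_; _∸_; _≤_; _<_; _/_; _%_; _≟_; _<?_; _⊓_; NonZero; z≤n; s≤s;
         >-nonZero; >-nonZero⁻¹; ≢-nonZero; ≢-nonZero⁻¹)
open import Data.Nat.Properties
open import Data.Nat.DivMod using (_mod_; m%n<n; m≡m%n+[m/n]*n; [m+kn]%n≡m%n; m<n⇒m%n≡m; m<n*o⇒m/o<n)
open import Data.Nat.Divisibility
  using (_∣_; _∣?_; divides; quotient; quotient≢0; m∣n⇒n≡m*quotient; m∣n⇒n≡quotient*m)
open import Data.Nat.GCD using (gcd; gcd[m,n]∣m; gcd[m,n]∣n; gcd[m,n]≢0)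
open import Data.Nat.Tactic.RingSolver using (solve-∀)
open import Data.List.Membership.DecPropositional _≟_ using () renaming (_∈?_ to _∈ₗ?_)
open import Data.Product using (_×_; _,_; ∃; uncurry)
open import Data.Sum using (_⊎_; inj₁; inj₂)
import Data.Vec as Vec
open import Data.Vec using (_∷_; []; lookup)
open import Function using (Injective; _∘_)
open import Function.Bundles using (module Equivalence)
open import Relation.Binary.PropositionalEquality
  using (_≡_; refl; sym; trans; cong; cong₂; subst; subst₂; module ≡-Reasoning)
open import Relation.Nullary using (¬_)
open import Relation.Nullary.Decidable using (Dec; yes; no; toWitness; from-yes; _→-dec_)

open Equivalence using (to; from)

fromList : ∀ {n} → List (Fin n) → Subset n
fromList xs = ⋃ (map ⁅_⁆ xs)

∈-⋃⁻ : ∀ {n} {x : Fin n} (ps : List (Subset n)) → x ∈ ⋃ ps → Any (x ∈_) ps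
∈-⋃⁻ []       x∈ = ⊥-elim (∉⊥ x∈)
∈-⋃⁻ (p ∷ ps) x∈ with x∈p∪q⁻ p (⋃ ps) x∈
... | inj₁ x∈p  = here x∈p
... | inj₂ x∈ps = there (∈-⋃⁻ ps x∈ps)

∈-⋃⁺ : ∀ {n} {x : Fin n} {ps : List (Subset n)} → Any (x ∈_) ps → x ∈ ⋃ ps
∈-⋃⁺ (here x∈p)   = x∈p∪q⁺ (inj₁ x∈p)
∈-⋃⁺ (there x∈ps) = x∈p∪q⁺ (inj₂ (∈-⋃⁺ x∈ps))

∈-⋃-concatMap⁻ : ∀ {a} {A : Set a} {n} {x : Fin n} (f : A → List (Subset n)) xs →
  x ∈ ⋃ (concatMap f xs) → ∃ λ y → x ∈ ⋃ (f y)
∈-⋃-concatMap⁻ f xs x∈ with satisfied (concatMap⁻ f {xs = xs} (∈-⋃⁻ (concatMap f xs) x∈))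
... | y , x∈fy = y , ∈-⋃⁺ x∈fy

∈-fromList⁺ : ∀ {n} {x : Fin n} {xs} → x ∈ₗ xs → x ∈ fromList xs
∈-fromList⁺ x∈xs = ∈-⋃⁺ (map⁺ (Any.map (λ { refl → x∈⁅x⁆ _ }) x∈xs))

∈-fromList⁻ : ∀ {n} {x : Fin n} xs → x ∈ fromList xs → x ∈ₗ xs
∈-fromList⁻ xs x∈ = Any.map (x∈⁅y⁆⇒x≡y _) (map⁻ (∈-⋃⁻ (map ⁅_⁆ xs) x∈))

∣⁅x⁆∪p∣≤1+∣p∣ : ∀ {n} (x : Fin n) (p : Subset n) → Subset.∣ ⁅ x ⁆ ∪ p ∣ ≤ suc Subset.∣ p ∣
∣⁅x⁆∪p∣≤1+∣p∣ fzero    (inside  ∷ p) rewrite ∪-identityˡ p = n≤1+n _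
∣⁅x⁆∪p∣≤1+∣p∣ fzero    (outside ∷ p) rewrite ∪-identityˡ p = ≤-refl
∣⁅x⁆∪p∣≤1+∣p∣ (fsuc x) (inside  ∷ p) = s≤s (∣⁅x⁆∪p∣≤1+∣p∣ x p)
∣⁅x⁆∪p∣≤1+∣p∣ (fsuc x) (outside ∷ p) = ∣⁅x⁆∪p∣≤1+∣p∣ x p

x∉p⇒∣⁅x⁆∪p∣≡1+∣p∣ : ∀ {n} (x : Fin n) (p : Subset n) → x ∉ p → Subset.∣ ⁅ x ⁆ ∪ p ∣ ≡ suc Subset.∣ p ∣
x∉p⇒∣⁅x⁆∪p∣≡1+∣p∣ fzero    (inside  ∷ p) x∉p = ⊥-elim (x∉p Vec.here)
x∉p⇒∣⁅x⁆∪p∣≡1+∣p∣ fzero    (outside ∷ p) x∉p rewrite ∪-identityˡ p = refl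
x∉p⇒∣⁅x⁆∪p∣≡1+∣p∣ (fsuc x) (inside  ∷ p) x∉p = cong suc (x∉p⇒∣⁅x⁆∪p∣≡1+∣p∣ x p (x∉p ∘ Vec.there))
x∉p⇒∣⁅x⁆∪p∣≡1+∣p∣ (fsuc x) (outside ∷ p) x∉p = x∉p⇒∣⁅x⁆∪p∣≡1+∣p∣ x p (x∉p ∘ Vec.there)

∣fromList∣≤length : ∀ {n} (xs : List (Fin n)) → Subset.∣ fromList xs ∣ ≤ length xs
∣fromList∣≤length {n} [] rewrite ∣⊥∣≡0 n = z≤n
∣fromList∣≤length (x ∷ xs) = ≤-trans (∣⁅x⁆∪p∣≤1+∣p∣ x (fromList xs)) (s≤s (∣fromList∣≤length xs))

∣fromList-tabulate∣ : ∀ {m n} (f : Fin m → Fin n) → Injective _≡_ _≡_ f →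
  Subset.∣ fromList (tabulate f) ∣ ≡ m
∣fromList-tabulate∣ {zero}  {n} f f-inj = ∣⊥∣≡0 n
∣fromList-tabulate∣ {suc m}     f f-inj =
  trans (x∉p⇒∣⁅x⁆∪p∣≡1+∣p∣ (f fzero) (fromList (tabulate (f ∘ fsuc))) f0∉)
        (cong suc (∣fromList-tabulate∣ (f ∘ fsuc) (fsuc-injective ∘ f-inj)))
  where
  f0∉ : f fzero ∉ fromList (tabulate (f ∘ fsuc))
  f0∉ f0∈ with ∈-tabulate⁻ {f = f ∘ fsuc} (∈-fromList⁻ _ f0∈)
  ... | i , f0≡fi with f-inj f0≡fi
  ... | ()

∈-allSubsets : ∀ {n} (p : Subset n) → p ∈ₗ allSubsets n
∈-allSubsets []      = here refl
∈-allSubsets (b ∷ p) =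
  ∈-concatMap⁺ (λ s → (false ∷ s) ∷ (true ∷ s) ∷ []) (Any.map (λ { refl → b∷p∈ b }) (∈-allSubsets p))
  where
  b∷p∈ : ∀ b → (b ∷ p) ∈ₗ ((false ∷ p) ∷ (true ∷ p) ∷ [])
  b∷p∈ false = here refl
  b∷p∈ true  = there (here refl)

foldr⊓≤ : ∀ y ys → foldr _⊓_ y ys ≤ y
foldr⊓≤ y []       = ≤-refl
foldr⊓≤ y (z ∷ zs) = ≤-trans (m⊓n≤n z _) (foldr⊓≤ y zs)

foldr⊓≤∈ : ∀ y ys {x} → x ∈ₗ ys → foldr _⊓_ y ys ≤ x
foldr⊓≤∈ y (z ∷ zs) (here refl) = m⊓n≤m z _
foldr⊓≤∈ y (z ∷ zs) (there x∈)  = ≤-trans (m⊓n≤n z _) (foldr⊓≤∈ y zs x∈)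

≤foldr⊓ : ∀ {k} y ys → k ≤ y → (∀ {x} → x ∈ₗ ys → k ≤ x) → k ≤ foldr _⊓_ y ys
≤foldr⊓ y []       k≤y k≤ys = k≤y
≤foldr⊓ y (z ∷ zs) k≤y k≤ys = ⊓-glb (k≤ys (here refl)) (≤foldr⊓ y zs k≤y (k≤ys ∘ there))

minList≤ : ∀ d xs {x} → x ∈ₗ xs → minList d xs ≤ x
minList≤ d (y ∷ ys) (here refl) = foldr⊓≤ y ys
minList≤ d (y ∷ ys) (there x∈)  = foldr⊓≤∈ y ys x∈

≤minList : ∀ d {k x} xs → x ∈ₗ xs → (∀ {y} → y ∈ₗ xs → k ≤ y) → k ≤ minList d xs
≤minList d (y ∷ ys) _ k≤xs = ≤foldr⊓ y ys (k≤xs (here refl)) (k≤xs ∘ there)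

-- Restricted sumsets

rhoHat3≤∣hat3∣ : ∀ n .{{_ : NonZero n}} {m} (A : Subset n) → Subset.∣ A ∣ ≡ m →
  rhoHat3 n m ≤ Subset.∣ hat3 n A ∣
rhoHat3≤∣hat3∣ n {m} A ∣A∣≡m =
  minList≤ n _ (∈-map⁺ (λ A → Subset.∣ hat3 n A ∣) (∈-filter⁺ (λ A → Subset.∣ A ∣ ≟ m) (∈-allSubsets A) ∣A∣≡m))

∈-hat3⁻ : ∀ n .{{_ : NonZero n}} (A : Subset n) {x} → x ∈ hat3 n A →
  ∃ λ a → ∃ λ b → ∃ λ c → T (distinctTripleIn A a b c) × x ≡ addZ n a b c
∈-hat3⁻ n A x∈ with ∈-⋃-concatMap⁻ _ (allFin n) x∈
... | a , x∈a with ∈-⋃-concatMap⁻ _ (allFin n) x∈a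
... | b , x∈b with ∈-⋃-concatMap⁻ _ (allFin n) x∈b
... | c , x∈c with distinctTripleIn A a b c in abc-distinct
... | false = ⊥-elim (∉⊥ x∈c)
... | true with x∈p∪q⁻ ⁅ addZ n a b c ⁆ Subset.⊥ x∈c
...   | inj₁ x∈abc = a , b , c , from T-≡ abc-distinct , x∈⁅y⁆⇒x≡y _ x∈abc
...   | inj₂ x∈⊥   = ⊥-elim (∉⊥ x∈⊥)

distinctTripleIn⇒ : ∀ {n} (A : Subset n) {a b c} → T (distinctTripleIn A a b c) →
  toℕ a < toℕ b × toℕ b < toℕ c × a ∈ A × b ∈ A × c ∈ A
distinctTripleIn⇒ A {a} {b} {c} abc-distinct =
  let a<b , t₁  = to T-∧ abc-distinct
      b<c , t₂  = to T-∧ t₁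
      a∈A , t₃  = to T-∧ t₂
      b∈A , c∈A = to T-∧ t₃
  in toWitness {a? = toℕ a <? toℕ b} a<b , toWitness {a? = toℕ b <? toℕ c} b<c ,
     toWitness {a? = a ∈? A} a∈A , toWitness {a? = b ∈? A} b∈A , toWitness {a? = c ∈? A} c∈A

rhoHat3≤length : ∀ n m .{{_ : NonZero n}} (x : Fin m → Fin n) → Injective _≡_ _≡_ x → (R : List (Fin n)) →
  (∀ i j k → toℕ (x i) < toℕ (x j) → toℕ (x j) < toℕ (x k) → addZ n (x i) (x j) (x k) ∈ₗ R) →
  rhoHat3 n m ≤ length R
rhoHat3≤length n m x x-inj R sums∈R = begin
  rhoHat3 n m            ≤⟨ rhoHat3≤∣hat3∣ n A (∣fromList-tabulate∣ x x-inj) ⟩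
  Subset.∣ hat3 n A ∣    ≤⟨ p⊆q⇒∣p∣≤∣q∣ (λ y∈ → sum∈R (∈-hat3⁻ n A y∈)) ⟩
  Subset.∣ fromList R ∣  ≤⟨ ∣fromList∣≤length R ⟩
  length R               ∎
  where
  open ≤-Reasoning
  A : Subset n
  A = fromList (tabulate x)
  index : ∀ {a} → a ∈ A → ∃ λ i → a ≡ x i
  index a∈A = ∈-tabulate⁻ {f = x} (∈-fromList⁻ _ a∈A)
  sum∈R′ : ∀ {a b c} → a ∈ A → b ∈ A → c ∈ A → toℕ a < toℕ b → toℕ b < toℕ c → addZ n a b c ∈ₗ R
  sum∈R′ a∈A b∈A c∈A with index a∈A | index b∈A | index c∈A
  ... | i , refl | j , refl | k , refl = sums∈R i j k
  -- A helper function rather than `with`: abstracting over `y ∈ hat3 n A`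
  -- makes Agda unfold hat3 and exhausts memory.
  sum∈R : ∀ {y} → (∃ λ a → ∃ λ b → ∃ λ c → T (distinctTripleIn A a b c) × y ≡ addZ n a b c) →
    y ∈ fromList R
  sum∈R (a , b , c , abc-distinct , refl) =
    let a<b , b<c , a∈A , b∈A , c∈A = distinctTripleIn⇒ A {a} {b} {c} abc-distinct
    in ∈-fromList⁺ (sum∈R′ a∈A b∈A c∈A a<b b<c)

-- Two-digit sets

%≡⇒mod≡ : ∀ n .{{_ : NonZero n}} {a b} → a % n ≡ b % n → a mod n ≡ b mod n
%≡⇒mod≡ n a%n≡b%n = toℕ-injective (trans (toℕ-fromℕ< _) (trans a%n≡b%n (sym (toℕ-fromℕ< _))))

m+n*o<p*o : ∀ {m n o p} → m < o → n < p → m + n * o < p * o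
m+n*o<p*o {m} {n} {o} m<o n<p = <-≤-trans (+-monoˡ-< (n * o) m<o) (*-monoˡ-≤ o n<p)

m+n*o-injective : ∀ {m n m′ n′ o} .{{_ : NonZero o}} → m < o → m′ < o →
  m + n * o ≡ m′ + n′ * o → m ≡ m′ × n ≡ n′
m+n*o-injective {m} {n} {m′} {n′} {o} m<o m′<o eq =
  m≡m′ , *-cancelʳ-≡ n n′ o (+-cancelˡ-≡ m′ _ _ (trans (cong (_+ n * o) (sym m≡m′)) eq))
  where
  open ≡-Reasoning
  m≡m′ : m ≡ m′
  m≡m′ = begin
    m                  ≡⟨ m<n⇒m%n≡m m<o ⟨
    m % o              ≡⟨ [m+kn]%n≡m%n m n o ⟨
    (m + n * o) % o    ≡⟨ cong (_% o) eq ⟩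
    (m′ + n′ * o) % o  ≡⟨ [m+kn]%n≡m%n m′ n′ o ⟩
    m′ % o             ≡⟨ m<n⇒m%n≡m m′<o ⟩
    m′                 ∎

%-/-injective : ∀ k .{{_ : NonZero k}} {i j} → i % k ≡ j % k → i / k ≡ j / k → i ≡ j
%-/-injective k {i} {j} i%k≡j%k i/k≡j/k = begin
  i                  ≡⟨ m≡m%n+[m/n]*n i k ⟩
  i % k + i / k * k  ≡⟨ cong₂ (λ r q → r + q * k) i%k≡j%k i/k≡j/k ⟩
  j % k + j / k * k  ≡⟨ m≡m%n+[m/n]*n j k ⟨
  j                  ∎
  where open ≡-Reasoning

[m+n*o]%N≡[m+[n%p]*o]%N : ∀ {o p N} .{{_ : NonZero p}} .{{_ : NonZero N}} → p * o ≡ N →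
  ∀ m n → (m + n * o) % N ≡ (m + (n % p) * o) % N
[m+n*o]%N≡[m+[n%p]*o]%N {o} {p} {N} p*o≡N m n = begin
  (m + n * o) % N                          ≡⟨ cong (λ n → (m + n * o) % N) (m≡m%n+[m/n]*n n p) ⟩
  (m + (n % p + n / p * p) * o) % N        ≡⟨ cong (_% N) (regroup m (n % p) (n / p) p o) ⟩
  (m + (n % p) * o + n / p * (p * o)) % N  ≡⟨ cong (λ N′ → (m + (n % p) * o + n / p * N′) % N) p*o≡N ⟩
  (m + (n % p) * o + n / p * N) % N        ≡⟨ [m+kn]%n≡m%n _ (n / p) N ⟩
  (m + (n % p) * o) % N                    ∎
  where
  open ≡-Reasoning
  regroup : ∀ m r k p o → m + (r + k * p) * o ≡ m + r * o + k * (p * o)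
  regroup = solve-∀

rhoHat3≤-digits : ∀ n d q m .{{_ : NonZero n}} .{{_ : NonZero d}} .{{_ : NonZero q}} → d * q ≡ n →
  (s t : Fin m → ℕ) → (∀ i → s i < q) → (∀ i → t i < d) → (∀ i j → s i ≡ s j → t i ≡ t j → i ≡ j) →
  (P : List (ℕ × ℕ)) →
  (∀ i j k → s i + t i * q < s j + t j * q → s j + t j * q < s k + t k * q →
     (s i + s j + s k , (t i + t j + t k) % d) ∈ₗ P) →
  rhoHat3 n m ≤ length P
rhoHat3≤-digits n d q m d*q≡n s t s<q t<d st-inj P sums∈P = begin
  rhoHat3 n m            ≤⟨ rhoHat3≤length n m x x-inj (map encode P) sums∈R ⟩
  length (map encode P)  ≡⟨ length-map encode P ⟩
  length P               ∎
  where
  open ≤-Reasoning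
  position : Fin m → ℕ
  position i = s i + t i * q
  x : Fin m → Fin n
  x i = fromℕ< (subst (position i <_) d*q≡n (m+n*o<p*o (s<q i) (t<d i)))
  toℕ-x : ∀ i → toℕ (x i) ≡ position i
  toℕ-x i = toℕ-fromℕ< _
  x-inj : Injective _≡_ _≡_ x
  x-inj {i} {j} xi≡xj = uncurry (st-inj i j)
    (m+n*o-injective (s<q i) (s<q j) (trans (sym (toℕ-x i)) (trans (cong toℕ xi≡xj) (toℕ-x j))))
  encode : ℕ × ℕ → Fin n
  encode (a , b) = (a + b * q) mod n
  sums∈R : ∀ i j k → toℕ (x i) < toℕ (x j) → toℕ (x j) < toℕ (x k) →
    addZ n (x i) (x j) (x k) ∈ₗ map encode P
  sums∈R i j k xi<xj xj<xk =
    subst (_∈ₗ map encode P) (sym addZ≡encode)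
      (∈-map⁺ encode (sums∈P i j k (subst₂ _<_ (toℕ-x i) (toℕ-x j) xi<xj) (subst₂ _<_ (toℕ-x j) (toℕ-x k) xj<xk)))
    where
    collect : ∀ a b c x y z w → (a + x * w) + (b + y * w) + (c + z * w) ≡ (a + b + c) + (x + y + z) * w
    collect = solve-∀
    addZ≡encode : addZ n (x i) (x j) (x k) ≡ encode (s i + s j + s k , (t i + t j + t k) % d)
    addZ≡encode = %≡⇒mod≡ n (≡.begin
      (toℕ (x i) + toℕ (x j) + toℕ (x k)) % n
        ≡.≡⟨ cong (_% n) (cong₂ _+_ (cong₂ _+_ (toℕ-x i) (toℕ-x j)) (toℕ-x k)) ⟩
      (position i + position j + position k) % n
        ≡.≡⟨ cong (_% n) (collect (s i) (s j) (s k) (t i) (t j) (t k) q) ⟩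
      (s i + s j + s k + (t i + t j + t k) * q) % n
        ≡.≡⟨ [m+n*o]%N≡[m+[n%p]*o]%N d*q≡n (s i + s j + s k) (t i + t j + t k) ⟩
      (s i + s j + s k + ((t i + t j + t k) % d) * q) % n
        ≡.∎)
      where module ≡ = ≡-Reasoning

length-cartesianProduct : ∀ {a b} {A : Set a} {B : Set b} (xs : List A) (ys : List B) →
  length (cartesianProduct xs ys) ≡ length xs * length ys
length-cartesianProduct []       ys = refl
length-cartesianProduct (x ∷ xs) ys =
  trans (length-++ (map (x ,_) ys)) (cong₂ _+_ (length-map _ ys) (length-cartesianProduct xs ys))

length-upTo×upTo : ∀ a b → length (cartesianProduct (upTo a) (upTo b)) ≡ a * b
length-upTo×upTo a b = trans (length-cartesianProduct (upTo a) (upTo b)) (cong₂ _*_ (length-upTo a) (length-upTo b))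

rhoHat3≤-lowDigitSums : ∀ n d q m L .{{_ : NonZero n}} .{{_ : NonZero d}} .{{_ : NonZero q}} → d * q ≡ n →
  (s t : Fin m → ℕ) → (∀ i → s i < q) → (∀ i → t i < d) → (∀ i j → s i ≡ s j → t i ≡ t j → i ≡ j) →
  (∀ i j k → s i + t i * q < s j + t j * q → s j + t j * q < s k + t k * q → s i + s j + s k < L) →
  rhoHat3 n m ≤ L * d
rhoHat3≤-lowDigitSums n d q m L d*q≡n s t s<q t<d st-inj sum<L = begin
  rhoHat3 n m  ≤⟨ rhoHat3≤-digits n d q m d*q≡n s t s<q t<d st-inj (cartesianProduct (upTo L) (upTo d))
                    (λ i j k i<j j<k → ∈-cartesianProduct⁺ (∈-upTo⁺ (sum<L i j k i<j j<k)) (∈-upTo⁺ (m%n<n _ d))) ⟩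
  length (cartesianProduct (upTo L) (upTo d))  ≡⟨ length-upTo×upTo L d ⟩
  L * d        ∎
  where open ≤-Reasoning

TripleSumsIn : ∀ {m} D .{{_ : NonZero D}} → (Fin m → Fin D) → List ℕ → Set
TripleSumsIn D a R = ∀ i j k → toℕ (a i) < toℕ (a j) → toℕ (a j) < toℕ (a k) →
  (toℕ (a i) + toℕ (a j) + toℕ (a k)) % D ∈ₗ R

tripleSumsIn? : ∀ {m} D .{{_ : NonZero D}} (a : Fin m → Fin D) R → Dec (TripleSumsIn D a R)
tripleSumsIn? D a R = all? λ i → all? λ j → all? λ k →
  (toℕ (a i) <? toℕ (a j)) →-dec ((toℕ (a j) <? toℕ (a k)) →-dec (_ ∈ₗ? R))

injective? : ∀ {m D} (a : Fin m → Fin D) → Dec (∀ i j → a i ≡ a j → i ≡ j)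
injective? a = all? λ i → all? λ j → (a i ≟ᶠ a j) →-dec (i ≟ᶠ j)

rhoHat3≤-dilation : ∀ n D m .{{_ : NonZero n}} .{{_ : NonZero D}} → D ∣ n →
  (a : Fin m → Fin D) → (∀ i j → a i ≡ a j → i ≡ j) → (R : List ℕ) → TripleSumsIn D a R →
  rhoHat3 n m ≤ length R
rhoHat3≤-dilation n D m D∣n a a-inj R sums∈R = begin
  rhoHat3 n m            ≤⟨ rhoHat3≤-digits n D q m (sym (m∣n⇒n≡m*quotient D∣n)) (λ _ → 0) (toℕ ∘ a)
                              (λ _ → >-nonZero⁻¹ q) (toℕ<n ∘ a) (λ i j _ → a-inj i j ∘ toℕ-injective)
                              (map high R) sums∈P ⟩
  length (map high R)    ≡⟨ length-map high R ⟩
  length R               ∎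
  where
  open ≤-Reasoning
  q : ℕ
  q = quotient D∣n
  instance
    q≢0 : NonZero q
    q≢0 = quotient≢0 D∣n
  high : ℕ → ℕ × ℕ
  high r = 0 , r
  sums∈P : ∀ i j k → toℕ (a i) * q < toℕ (a j) * q → toℕ (a j) * q < toℕ (a k) * q →
    (0 , (toℕ (a i) + toℕ (a j) + toℕ (a k)) % D) ∈ₗ map high R
  sums∈P i j k ai<aj aj<ak = ∈-map⁺ high (sums∈R i j k (*-cancelʳ-< q _ _ ai<aj) (*-cancelʳ-< q _ _ aj<ak))

+-mono₃-≤ : ∀ x y z {a b c K} → x + a ≤ K → y + b ≤ K → z + c ≤ K → x + y + z + (a + b + c) ≤ 3 * K
+-mono₃-≤ x y z {a} {b} {c} {K} xa≤K yb≤K zc≤K =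
  subst₂ _≤_ (regroup x y z a b c) (triple K) (+-mono-≤ (+-mono-≤ xa≤K yb≤K) zc≤K)
  where
  regroup : ∀ x y z a b c → x + a + (y + b) + (z + c) ≡ x + y + z + (a + b + c)
  regroup = solve-∀
  triple : ∀ K → K + K + K ≡ 3 * K
  triple = solve-∀

3+S≤3K⇒S<3K∸3+1 : ∀ {S} K → 3 + S ≤ 3 * K → S < 3 * K ∸ 3 + 1
3+S≤3K⇒S<3K∸3+1 {S} K 3+S≤3K =
  subst (S <_) (+-comm 1 (3 * K ∸ 3)) (s≤s (m+n≤o⇒m≤o∸n S (subst (_≤ 3 * K) (+-comm 3 S) 3+S≤3K)))

2+S≤3K⇒S<3K∸1 : ∀ {S} K → 2 + S ≤ 3 * K → S < 3 * K ∸ 1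
2+S≤3K⇒S<3K∸1 {S} K 2+S≤3K = m+n≤o⇒m≤o∸n (suc S) (subst (_≤ 3 * K) (trans (+-comm 2 S) (+-suc S 1)) 2+S≤3K)

a<b<c<3⇒a+b+c≡3 : ∀ {a b c} → a < b → b < c → c < 3 → a + b + c ≡ 3
a<b<c<3⇒a+b+c≡3 {a} {b} {c} a<b b<c c<3 =
  ≤-antisym (+-mono-≤ (+-mono-≤ a≤0 b≤1) c≤2) (+-mono-≤ (+-mono-≤ (z≤n {a}) 1≤b) (≤-trans (s≤s 1≤b) b<c))
  where
  c≤2 : c ≤ 2
  c≤2 = ≤-pred c<3
  b≤1 : b ≤ 1
  b≤1 = ≤-pred (<-≤-trans b<c c≤2)
  a≤0 : a ≤ 0
  a≤0 = ≤-pred (<-≤-trans a<b b≤1)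
  1≤b : 1 ≤ b
  1≤b = ≤-trans (s≤s z≤n) a<b

a+b+c≡0⇒equal : ∀ a b c → a + b + c ≡ 0 → a ≡ b × b ≡ c
a+b+c≡0⇒equal a b c S≡0 = trans a≡0 (sym b≡0) , trans b≡0 (sym c≡0)
  where
  a≡0 : a ≡ 0
  a≡0 = m+n≡0⇒m≡0 a (m+n≡0⇒m≡0 (a + b) S≡0)
  b≡0 : b ≡ 0
  b≡0 = m+n≡0⇒n≡0 a (m+n≡0⇒m≡0 (a + b) S≡0)
  c≡0 : c ≡ 0
  c≡0 = m+n≡0⇒n≡0 (a + b) S≡0

a+b+c≡3K⇒equal : ∀ {a b c K} → a ≤ K → b ≤ K → c ≤ K → a + b + c ≡ 3 * K → a ≡ b × b ≡ c
a+b+c≡3K⇒equal {a} {b} {c} {K} a≤K b≤K c≤K S≡3K = trans a≡K (sym b≡K) , trans b≡K (sym c≡K)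
  where
  below : 1 + (a + b + c) ≤ 3 * K → ⊥
  below = <-irrefl S≡3K
  a≡K : a ≡ K
  a≡K with m≤n⇒m<n∨m≡n a≤K
  ... | inj₁ a<K = ⊥-elim (below (+-mono₃-≤ 1 0 0 a<K b≤K c≤K))
  ... | inj₂ a≡K = a≡K
  b≡K : b ≡ K
  b≡K with m≤n⇒m<n∨m≡n b≤K
  ... | inj₁ b<K = ⊥-elim (below (+-mono₃-≤ 0 1 0 a≤K b<K c≤K))
  ... | inj₂ b≡K = b≡K
  c≡K : c ≡ K
  c≡K with m≤n⇒m<n∨m≡n c≤K
  ... | inj₁ c<K = ⊥-elim (below (+-mono₃-≤ 0 0 1 a≤K b≤K c<K))
  ... | inj₂ c≡K = c≡K

rhoHat3≤-blocks : ∀ n d q m K .{{_ : NonZero n}} .{{_ : NonZero d}} .{{_ : NonZero q}} .{{_ : NonZero K}} →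
  d * q ≡ n → K ≤ q → m ≤ K * d → rhoHat3 n m ≤ (3 * K ∸ 3 + 1) * d
rhoHat3≤-blocks n d q m K d*q≡n K≤q m≤K*d =
  rhoHat3≤-lowDigitSums n d q m (3 * K ∸ 3 + 1) d*q≡n s t (λ i → <-≤-trans (m%n<n (toℕ i) K) K≤q) t<d
    (λ i j si≡sj ti≡tj → toℕ-injective (%-/-injective K si≡sj ti≡tj))
    (λ i j k _ _ → 3+S≤3K⇒S<3K∸3+1 K (+-mono₃-≤ 1 1 1 (m%n<n (toℕ i) K) (m%n<n (toℕ j) K) (m%n<n (toℕ k) K)))
  where
  s t : Fin m → ℕ
  s i = toℕ i % K
  t i = toℕ i / K
  t<d : ∀ i → t i < d
  t<d i = m<n*o⇒m/o<n (<-≤-trans (toℕ<n i) (subst (m ≤_) (*-comm K d) m≤K*d))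

m≤ceilDiv*d : ∀ m d .{{_ : NonZero d}} → m ≤ ceilDiv m d * d
m≤ceilDiv*d m d@(suc d′) = +-cancelˡ-≤ d′ m (ceilDiv m d * d) (begin
  d′ + m                             ≡⟨ +-comm d′ m ⟩
  m + d′                             ≡⟨ cong (_∸ 1) (+-suc m d′) ⟨
  m + d ∸ 1                          ≡⟨ m≡m%n+[m/n]*n (m + d ∸ 1) d ⟩
  (m + d ∸ 1) % d + ceilDiv m d * d  ≤⟨ +-monoˡ-≤ (ceilDiv m d * d) (≤-pred (m%n<n (m + d ∸ 1) d)) ⟩
  d′ + ceilDiv m d * d               ∎)
  where open ≤-Reasoning

ceilDiv≤ : ∀ {m q} d .{{_ : NonZero d}} → m ≤ q * d → ceilDiv m d ≤ q
ceilDiv≤ {m} {q} d@(suc d′) m≤q*d = ≤-pred (m<n*o⇒m/o<n (begin-strict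
  m + d ∸ 1   ≡⟨ cong (_∸ 1) (+-suc m d′) ⟩
  m + d′      ≤⟨ +-monoˡ-≤ d′ m≤q*d ⟩
  q * d + d′  <⟨ +-monoʳ-< (q * d) (n<1+n d′) ⟩
  q * d + d   ≡⟨ +-comm (q * d) d ⟩
  suc q * d   ∎))
  where open ≤-Reasoning

ceilDiv-nonZero : ∀ {m} d .{{_ : NonZero d}} → 1 ≤ m → NonZero (ceilDiv m d)
ceilDiv-nonZero {m} d 1≤m = ≢-nonZero λ ceil≡0 →
  <⇒≱ 1≤m (subst (λ c → m ≤ c * d) ceil≡0 (m≤ceilDiv*d m d))

rhoHat3≤u-term : ∀ n m d .{{_ : NonZero n}} .{{_ : NonZero d}} → 1 ≤ m → m ≤ n → d ∣ n →
  rhoHat3 n m ≤ (3 * ceilDiv m d ∸ 3 + 1) * d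
rhoHat3≤u-term n m d 1≤m m≤n d∣n =
  rhoHat3≤-blocks n d q m (ceilDiv m d) (sym (m∣n⇒n≡m*quotient d∣n)) (ceilDiv≤ d m≤q*d) (m≤ceilDiv*d m d)
  where
  q : ℕ
  q = quotient d∣n
  instance
    q≢0 : NonZero q
    q≢0 = quotient≢0 d∣n
    ceil≢0 : NonZero (ceilDiv m d)
    ceil≢0 = ceilDiv-nonZero d 1≤m
  m≤q*d : m ≤ q * d
  m≤q*d = subst (m ≤_) (trans (m∣n⇒n≡m*quotient d∣n) (*-comm d q)) m≤n

rhoHat3≤u : ∀ n m .{{_ : NonZero n}} → 1 ≤ m → m ≤ n → rhoHat3 n m ≤ u n m 3
rhoHat3≤u n m 1≤m m≤n = ≤minList 0 _ (∈-map⁺ _ 1∈divisors) bounded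
  where
  1∈divisors : 1 ∈ₗ divisors n
  1∈divisors = ∈-filter⁺ (_∣? n) (∈-applyUpTo⁺ suc (>-nonZero⁻¹ n)) (divides n (sym (*-identityʳ n)))
  -- The `_` is the function `term` local to `u`, which cannot be named here.
  bounded : ∀ {y} → y ∈ₗ map _ (divisors n) → rhoHat3 n m ≤ y
  bounded y∈ with ∈-map⁻ _ y∈
  ... | d , d∈ , refl with ∈-filter⁻ (_∣? n) {xs = applyUpTo suc n} d∈
  ... | d∈range , d∣n with ∈-applyUpTo⁻ suc d∈range
  ... | d′ , _ , refl = rhoHat3≤u-term n m (suc d′) 1≤m m≤n d∣n

rhoHat3≤-gcd : ∀ n m g .{{_ : NonZero n}} .{{_ : NonZero g}} → 2 ≤ m → m ≤ n → g ∣ n → g ∣ m ∸ 1 →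
  rhoHat3 n m ≤ 3 * m ∸ 3 ∸ g
rhoHat3≤-gcd n m@(suc M) g 2≤m m≤n g∣n g∣M = begin
  rhoHat3 n m      ≤⟨ rhoHat3≤-lowDigitSums n g q m (3 * K ∸ 1) (sym (m∣n⇒n≡m*quotient g∣n)) s t s<q t<g st-inj S< ⟩
  (3 * K ∸ 1) * g  ≡⟨ length≡ ⟩
  3 * m ∸ 3 ∸ g    ∎
  where
  open ≤-Reasoning
  q K : ℕ
  q = quotient g∣n
  K = quotient g∣M
  instance
    q≢0 : NonZero q
    q≢0 = quotient≢0 g∣n
    K≢0 : NonZero K
    K≢0 = quotient≢0 g∣M {{>-nonZero (≤-pred 2≤m)}}
  M≡g*K : M ≡ g * K
  M≡g*K = m∣n⇒n≡m*quotient g∣M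
  K<q : K < q
  K<q = *-cancelˡ-< g K q (subst₂ _<_ M≡g*K (m∣n⇒n≡m*quotient g∣n) m≤n)
  s t : Fin m → ℕ
  s fzero    = K
  s (fsuc i) = toℕ i % K
  t fzero    = 0
  t (fsuc i) = toℕ i / K
  s<q : ∀ i → s i < q
  s<q fzero    = K<q
  s<q (fsuc i) = <-trans (m%n<n (toℕ i) K) K<q
  t<g : ∀ i → t i < g
  t<g fzero    = >-nonZero⁻¹ g
  t<g (fsuc i) = m<n*o⇒m/o<n (subst (toℕ i <_) M≡g*K (toℕ<n i))
  st-inj : ∀ i j → s i ≡ s j → t i ≡ t j → i ≡ j
  st-inj fzero    fzero    _     _     = refl
  st-inj fzero    (fsuc j) K≡s   _     = ⊥-elim (<-irrefl (sym K≡s) (m%n<n (toℕ j) K))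
  st-inj (fsuc i) fzero    s≡K   _     = ⊥-elim (<-irrefl s≡K (m%n<n (toℕ i) K))
  st-inj (fsuc i) (fsuc j) si≡sj ti≡tj = cong fsuc (toℕ-injective (%-/-injective K si≡sj ti≡tj))
  position : Fin m → ℕ
  position i = s i + t i * q
  low : ∀ i → 1 + s (fsuc i) ≤ K
  low i = m%n<n (toℕ i) K
  -- Only fzero has low digit K, and the three indices are distinct.
  S< : ∀ i j k → position i < position j → position j < position k → s i + s j + s k < 3 * K ∸ 1
  S< fzero    fzero    _        p<p _   = ⊥-elim (<-irrefl refl p<p)
  S< _        fzero    fzero    _   p<p = ⊥-elim (<-irrefl refl p<p)
  S< fzero    _        fzero    p<q q<p = ⊥-elim (<-asym p<q q<p)
  S< fzero    (fsuc j) (fsuc k) _   _   = 2+S≤3K⇒S<3K∸1 K (+-mono₃-≤ 0 1 1 ≤-refl (low j) (low k))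
  S< (fsuc i) fzero    (fsuc k) _   _   = 2+S≤3K⇒S<3K∸1 K (+-mono₃-≤ 1 0 1 (low i) ≤-refl (low k))
  S< (fsuc i) (fsuc j) fzero    _   _   = 2+S≤3K⇒S<3K∸1 K (+-mono₃-≤ 1 1 0 (low i) (low j) ≤-refl)
  S< (fsuc i) (fsuc j) (fsuc k) _   _   =
    2+S≤3K⇒S<3K∸1 K (≤-trans (n≤1+n _) (+-mono₃-≤ 1 1 1 (low i) (low j) (low k)))
  length≡ : (3 * K ∸ 1) * g ≡ 3 * m ∸ 3 ∸ g
  length≡ = ≡.begin
    (3 * K ∸ 1) * g    ≡.≡⟨ *-distribʳ-∸ g (3 * K) 1 ⟩
    3 * K * g ∸ 1 * g  ≡.≡⟨ cong₂ _∸_ (trans (*-assoc 3 K g) (cong (3 *_) (*-comm K g))) (*-identityˡ g) ⟩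
    3 * (g * K) ∸ g    ≡.≡⟨ cong (λ M → 3 * M ∸ g) M≡g*K ⟨
    3 * M ∸ g          ≡.≡⟨ cong (_∸ g) (trans (cong (_∸ 3) (*-suc 3 M)) (m+n∸m≡n 3 (3 * M))) ⟨
    3 * m ∸ 3 ∸ g      ≡.∎
    where module ≡ = ≡-Reasoning

rhoHat3≤-interval : ∀ n m .{{_ : NonZero n}} → m ≤ n → rhoHat3 n m ≤ 3 * m ∸ 8
rhoHat3≤-interval n m m≤n = begin
  rhoHat3 n m  ≤⟨ rhoHat3≤length n m x (inject≤-injective m≤n m≤n _ _) R sums∈R ⟩
  length R     ≡⟨ length-applyUpTo shift (3 * m ∸ 8) ⟩
  3 * m ∸ 8    ∎
  where
  open ≤-Reasoning
  x : Fin m → Fin n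
  x i = inject≤ i m≤n
  shift : ℕ → Fin n
  shift r = (3 + r) mod n
  R : List (Fin n)
  R = applyUpTo shift (3 * m ∸ 8)
  sums∈R : ∀ i j k → toℕ (x i) < toℕ (x j) → toℕ (x j) < toℕ (x k) → addZ n (x i) (x j) (x k) ∈ₗ R
  sums∈R i j k a<b b<c = subst (_∈ₗ R) (cong (_mod n) (m+[n∸m]≡n 3≤S)) (∈-applyUpTo⁺ shift S∸3<)
    where
    S : ℕ
    S = toℕ (x i) + toℕ (x j) + toℕ (x k)
    c<m : toℕ (x k) < m
    c<m = subst (_< m) (sym (toℕ-inject≤ k m≤n)) (toℕ<n k)
    1≤b : 1 ≤ toℕ (x j)
    1≤b = ≤-trans (s≤s z≤n) a<b
    3≤S : 3 ≤ S
    3≤S = +-mono-≤ (+-mono-≤ (z≤n {toℕ (x i)}) 1≤b) (≤-trans (s≤s 1≤b) b<c)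
    6+S≤3m : 6 + S ≤ 3 * m
    6+S≤3m = +-mono₃-≤ 3 2 1 (≤-trans (s≤s (s≤s a<b)) (≤-trans (s≤s b<c) c<m)) (≤-trans (s≤s b<c) c<m) c<m
    S∸3< : S ∸ 3 < 3 * m ∸ 8
    S∸3< = m+n≤o⇒m≤o∸n (suc (S ∸ 3)) (subst (_≤ 3 * m) (sym (trans (shuffle (S ∸ 3)) (cong (6 +_) (m+[n∸m]≡n 3≤S)))) 6+S≤3m)
      where
      shuffle : ∀ r → suc r + 8 ≡ 6 + (3 + r)
      shuffle = solve-∀

rhoHat3≤-three : ∀ n m .{{_ : NonZero n}} → 4 ≤ m → m ≤ n → 3 ∣ n → 3 ∣ m → rhoHat3 n m ≤ 3 * m ∸ 10
rhoHat3≤-three n m 4≤m m≤n 3∣n (divides 0 m≡0) = ⊥-elim (<-irrefl (sym m≡0) (≤-trans (s≤s z≤n) 4≤m))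
rhoHat3≤-three n m 4≤m m≤n 3∣n (divides 1 m≡3) = ⊥-elim (<-irrefl (sym m≡3) 4≤m)
rhoHat3≤-three n m 4≤m m≤n 3∣n (divides J@(suc (suc x)) m≡J*3) = begin
  rhoHat3 n m  ≤⟨ rhoHat3≤-digits n 3 q m (sym (m∣n⇒n≡m*quotient 3∣n)) s t
                    (λ i → <-≤-trans (m%n<n (toℕ i) J) J≤q) t<3
                    (λ i j si≡sj ti≡tj → toℕ-injective (%-/-injective J si≡sj ti≡tj)) P sums∈P ⟩
  length P     ≡⟨ length≡ ⟩
  3 * m ∸ 10   ∎
  where
  open ≤-Reasoning
  q : ℕ
  q = quotient 3∣n
  instance
    q≢0 : NonZero q
    q≢0 = quotient≢0 3∣n
  J≤q : J ≤ q
  J≤q = *-cancelʳ-≤ J q 3 (subst₂ _≤_ m≡J*3 (m∣n⇒n≡quotient*m 3∣n) m≤n)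
  s t : Fin m → ℕ
  s i = toℕ i % J
  t i = toℕ i / J
  t<3 : ∀ i → t i < 3
  t<3 i = m<n*o⇒m/o<n (subst (toℕ i <_) (trans m≡J*3 (*-comm J 3)) (toℕ<n i))
  top : ℕ
  top = 3 * suc x
  P : List (ℕ × ℕ)
  P = (0 , 0) ∷ (top , 0) ∷ cartesianProduct (applyUpTo suc (2 + 3 * x)) (upTo 3)
  length≡ : length P ≡ 3 * m ∸ 10
  length≡ = begin-equality
    2 + length (cartesianProduct (applyUpTo suc (2 + 3 * x)) (upTo 3))
      ≡⟨ cong (2 +_) (trans (length-cartesianProduct (applyUpTo suc (2 + 3 * x)) (upTo 3))
                            (cong₂ _*_ (length-applyUpTo suc (2 + 3 * x)) (length-upTo 3))) ⟩
    2 + (2 + 3 * x) * 3   ≡⟨ m+n∸m≡n 10 _ ⟨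
    10 + (2 + (2 + 3 * x) * 3) ∸ 10 ≡⟨ cong (_∸ 10) (expand x) ⟩
    3 * (J * 3) ∸ 10      ≡⟨ cong (λ m → 3 * m ∸ 10) m≡J*3 ⟨
    3 * m ∸ 10            ∎
    where
    expand : ∀ x → 10 + (2 + (2 + 3 * x) * 3) ≡ 3 * ((2 + x) * 3)
    expand = solve-∀
  ∈P : ∀ S T → S ≤ top → T < 3 → (S ≡ 0 → T ≡ 0) → (S ≡ top → T ≡ 0) → (S , T) ∈ₗ P
  ∈P zero    T _ _ T≡0 _ = here (cong (0 ,_) (T≡0 refl))
  ∈P (suc S) T S≤top T<3 _ T≡0 with suc S ≟ top
  ... | yes S≡top = there (here (cong₂ _,_ S≡top (T≡0 S≡top)))
  ... | no  S≢top = there (there (∈-cartesianProduct⁺ (∈-applyUpTo⁺ suc S<) (∈-upTo⁺ T<3)))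
    where
    S< : S < 2 + 3 * x
    S< = ≤-pred (subst (suc S <_) (top≡ x) (≤∧≢⇒< S≤top S≢top))
      where
      top≡ : ∀ x → 3 * suc x ≡ 3 + 3 * x
      top≡ = solve-∀
  position : Fin m → ℕ
  position i = s i + t i * q
  t-increasing : ∀ i j → s i ≡ s j → position i < position j → t i < t j
  t-increasing i j si≡sj pi<pj =
    *-cancelʳ-< q (t i) (t j) (+-cancelˡ-< (s j) _ _ (subst (λ r → r + t i * q < position j) si≡sj pi<pj))
  -- A low-digit sum of 0 or top forces equal low digits, hence distinct high digits 0, 1, 2.
  sums∈P : ∀ i j k → position i < position j → position j < position k →
    (s i + s j + s k , (t i + t j + t k) % 3) ∈ₗ P
  sums∈P i j k pi<pj pj<pk = ∈P _ _ (+-mono₃-≤ 0 0 0 (s≤top i) (s≤top j) (s≤top k)) (m%n<n (t i + t j + t k) 3)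
    (equal⇒T≡0 ∘ a+b+c≡0⇒equal (s i) (s j) (s k))
    (equal⇒T≡0 ∘ a+b+c≡3K⇒equal (s≤top i) (s≤top j) (s≤top k))
    where
    s≤top : ∀ i → s i ≤ suc x
    s≤top i = ≤-pred (m%n<n (toℕ i) J)
    equal⇒T≡0 : s i ≡ s j × s j ≡ s k → (t i + t j + t k) % 3 ≡ 0
    equal⇒T≡0 (si≡sj , sj≡sk) = cong (_% 3)
      (a<b<c<3⇒a+b+c≡3 (t-increasing i j si≡sj pi<pj) (t-increasing j k sj≡sk pj<pk) (t<3 k))

rhoHat3[n,6]≤9 : ∀ n .{{_ : NonZero n}} → 10 ∣ n → rhoHat3 n 6 ≤ 9
rhoHat3[n,6]≤9 n 10∣n = rhoHat3≤-dilation n 10 6 10∣n a (from-yes (injective? a)) R (from-yes (tripleSumsIn? 10 a R))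
  where
  a : Fin 6 → Fin 10
  a = lookup (# 0 ∷ # 1 ∷ # 2 ∷ # 4 ∷ # 5 ∷ # 6 ∷ [])
  R : List ℕ
  R = 0 ∷ 1 ∷ 2 ∷ 3 ∷ 5 ∷ 6 ∷ 7 ∷ 8 ∷ 9 ∷ []

rhoHat3[n,8]≤14 : ∀ n .{{_ : NonZero n}} → 15 ∣ n → rhoHat3 n 8 ≤ 14
rhoHat3[n,8]≤14 n 15∣n = rhoHat3≤-dilation n 15 8 15∣n a (from-yes (injective? a)) R (from-yes (tripleSumsIn? 15 a R))
  where
  a : Fin 8 → Fin 15
  a = lookup (# 0 ∷ # 1 ∷ # 3 ∷ # 4 ∷ # 6 ∷ # 9 ∷ # 10 ∷ # 13 ∷ [])
  R : List ℕ
  R = 0 ∷ 1 ∷ 2 ∷ 3 ∷ 4 ∷ 5 ∷ 7 ∷ 8 ∷ 9 ∷ 10 ∷ 11 ∷ 12 ∷ 13 ∷ 14 ∷ []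

-- m = 8 is sporadic, m = 13 uses the subgroup of order 15, and m ≥ 18 uses
-- two blocks over the subgroup of order (3m − 9)/5.
rhoHat3≤-3+5k : ∀ n k .{{_ : NonZero n}} → let m = 3 + suc k * 5 in
  (3 * m ∸ 9) ∣ n → rhoHat3 n m ≤ 3 * m ∸ 10
rhoHat3≤-3+5k n 0 15∣n = rhoHat3[n,8]≤14 n 15∣n
rhoHat3≤-3+5k n 1 30∣n =
  ≤-trans (rhoHat3≤-blocks n 15 (2 * c) 13 1 15*[2c]≡n (>-nonZero⁻¹ (2 * c)) (m≤m+n 13 2)) (m≤m+n 15 14)
  where
  c : ℕ
  c = quotient 30∣n
  instance
    c≢0 : NonZero c
    c≢0 = quotient≢0 30∣n
    2c≢0 : NonZero (2 * c)
    2c≢0 = m*n≢0 2 c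
  15*[2c]≡n : 15 * (2 * c) ≡ n
  15*[2c]≡n = trans (sym (*-assoc 15 2 c)) (sym (m∣n⇒n≡m*quotient 30∣n))
rhoHat3≤-3+5k n (suc (suc x)) 15k∣n = begin
  rhoHat3 n m                      ≤⟨ rhoHat3≤-blocks n d (5 * c) m 2 d*5c≡n 2≤5c m≤2d ⟩
  4 * d                            ≤⟨ m≤m+n (4 * d) (3 * x + 8) ⟩
  4 * d + (3 * x + 8)              ≡⟨ m+n∸m≡n 10 _ ⟨
  10 + (4 * d + (3 * x + 8)) ∸ 10  ≡⟨ cong (_∸ 10) (expand₁₀ x) ⟩
  3 * m ∸ 10                       ∎
  where
  open ≤-Reasoning
  m d c : ℕ
  m = 3 + (3 + x) * 5
  d = 9 + 3 * x
  c = quotient 15k∣n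
  instance
    c≢0 : NonZero c
    c≢0 = quotient≢0 15k∣n
    5c≢0 : NonZero (5 * c)
    5c≢0 = m*n≢0 5 c
  expand₉ : ∀ x → 9 + 5 * (9 + 3 * x) ≡ 3 * (3 + (3 + x) * 5)
  expand₉ = solve-∀
  expand₁₀ : ∀ x → 10 + (4 * (9 + 3 * x) + (3 * x + 8)) ≡ 3 * (3 + (3 + x) * 5)
  expand₁₀ = solve-∀
  reassoc : ∀ d c → d * (5 * c) ≡ 5 * d * c
  reassoc = solve-∀
  d*5c≡n : d * (5 * c) ≡ n
  d*5c≡n = trans (reassoc d c) (trans (cong (_* c) (trans (sym (m+n∸m≡n 9 (5 * d))) (cong (_∸ 9) (expand₉ x))))
                                      (sym (m∣n⇒n≡m*quotient 15k∣n)))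
  2≤5c : 2 ≤ 5 * c
  2≤5c = ≤-trans (m≤m+n 2 3) (m≤m*n 5 c)
  m≤2d : m ≤ 2 * d
  m≤2d = subst₂ _≤_ (m≡ x) (2d≡ x) (+-monoʳ-≤ 18 (*-monoˡ-≤ x (m≤m+n 5 1)))
    where
    m≡ : ∀ x → 18 + 5 * x ≡ 3 + (3 + x) * 5
    m≡ = solve-∀
    2d≡ : ∀ x → 18 + 6 * x ≡ 2 * (9 + 3 * x)
    2d≡ = solve-∀

rhoHat3≤-5∣m∸3 : ∀ n m .{{_ : NonZero n}} → 4 ≤ m → (3 * m ∸ 9) ∣ n → 5 ∣ m ∸ 3 → rhoHat3 n m ≤ 3 * m ∸ 10
rhoHat3≤-5∣m∸3 n m 4≤m _ (divides zero m∸3≡0) = ⊥-elim (<-irrefl (sym m∸3≡0) (∸-monoˡ-≤ 3 4≤m))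
rhoHat3≤-5∣m∸3 n m 4≤m [3m∸9]∣n (divides (suc k) m∸3≡[1+k]*5) =
  subst (λ m → (3 * m ∸ 9) ∣ n → rhoHat3 n m ≤ 3 * m ∸ 10) (sym m≡3+[1+k]*5) (rhoHat3≤-3+5k n k) [3m∸9]∣n
  where
  m≡3+[1+k]*5 : m ≡ 3 + suc k * 5
  m≡3+[1+k]*5 = trans (sym (m+[n∸m]≡n (≤-trans (n≤1+n 3) 4≤m))) (cong (3 +_) m∸3≡[1+k]*5)

corollary4p2 : (n m : ℕ) .{{_ : NonZero n}} → 4 ≤ m → m ≤ n →
    let g = gcd n (m ∸ 1)
        C1 = 8 ≤ g
        C2 = (g ≡ 7) ⊎ ((g ≤ 5 × 3 ∣ n × 3 ∣ m) ⊎ (g ≤ 5 × (3 * m ∸ 9) ∣ n × 5 ∣ (m ∸ 3)))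
        C3 = (g ≡ 6) ⊎ (m ≡ 6 × 10 ∣ n × ¬ (3 ∣ n))
    in (C1 → rhoHat3 n m ≤ u n m 3 ⊓ (3 * m ∸ 3 ∸ g))
     × (C2 → rhoHat3 n m ≤ u n m 3 ⊓ (3 * m ∸ 10))
     × (C3 → rhoHat3 n m ≤ u n m 3 ⊓ (3 * m ∸ 9))
     × (¬ C1 → ¬ C2 → ¬ C3 → rhoHat3 n m ≤ u n m 3 ⊓ (3 * m ∸ 8))
corollary4p2 n m 4≤m m≤n =
    (λ _ → with-u ρ≤gcd)
  , (λ { (inj₁ g≡7)                      → with-u (ρ≤gcd-when g≡7)
       ; (inj₂ (inj₁ (_ , 3∣n , 3∣m)))      → with-u (rhoHat3≤-three n m 4≤m m≤n 3∣n 3∣m)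
       ; (inj₂ (inj₂ (_ , [3m∸9]∣n , 5∣m∸3))) → with-u (rhoHat3≤-5∣m∸3 n m 4≤m [3m∸9]∣n 5∣m∸3) })
  , (λ { (inj₁ g≡6)              → with-u (ρ≤gcd-when g≡6)
       ; (inj₂ (m≡6 , 10∣n , _)) → with-u (subst (λ m → rhoHat3 n m ≤ 3 * m ∸ 9) (sym m≡6) (rhoHat3[n,6]≤9 n 10∣n)) })
  , (λ _ _ _ → with-u (rhoHat3≤-interval n m m≤n))
  where
  g : ℕ
  g = gcd n (m ∸ 1)
  instance
    g≢0 : NonZero g
    g≢0 = ≢-nonZero (gcd[m,n]≢0 n (m ∸ 1) (inj₁ (≢-nonZero⁻¹ n)))
  with-u : ∀ {b} → rhoHat3 n m ≤ b → rhoHat3 n m ≤ u n m 3 ⊓ b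
  with-u = ⊓-glb (rhoHat3≤u n m (≤-trans (s≤s z≤n) 4≤m) m≤n)
  ρ≤gcd : rhoHat3 n m ≤ 3 * m ∸ 3 ∸ g
  ρ≤gcd = rhoHat3≤-gcd n m g (≤-trans (s≤s (s≤s z≤n)) 4≤m) m≤n (gcd[m,n]∣m n (m ∸ 1)) (gcd[m,n]∣n n (m ∸ 1))
  ρ≤gcd-when : ∀ {k} → g ≡ k → rhoHat3 n m ≤ 3 * m ∸ (3 + k)
  ρ≤gcd-when refl = subst (rhoHat3 n m ≤_) (∸-+-assoc (3 * m) 3 g) ρ≤gcd
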